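{- Let $m\ge 0$ be an integer and $k=4m+3$. Let $n\ge 0$, and let $x_i,y_i,z_i\in\{0,1\}$ for $i=0,\dots,n$. For $t=0,1,\dots,n$ define $S_t=\sum_{i=n-t}^{n}(x_i+z_i-ky_i)2^i$. Let $t$ be an integer with $0\le t\le n-1$ and suppose that $(2m+2)\cdot 2^{n-t}\le S_t<k\cdot 2^{n-t}$ and $x_i\oplus y_i\oplus z_i=0$ for $i=n,n-1,\dots,n-t$. Then: (a) if $(x_{n-t-1},y_{n-t-1},z_{n-t-1})=(1,1,0)$ or $(0,1,1)$, then $0\le S_{t+1}<k\cdot 2^{n-t-1}$; (b) if $(x_{n-t-1},y_{n-t-1},z_{n-t-1})=(1,0,1)$ or $(0,0,0)$, then $S_{t+1}\ge k\cdot 2^{n-t-1}$.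
   Context: $\oplus$ denotes nim-sum (XOR); for bits this is addition modulo 2. -}

module Defs where

open import Data.Nat using (ℕ; zero; suc; _∸_; _^_)
open import Data.Integer using (ℤ; +_; _+_; _-_; _*_)
open import Data.Bool using (Bool; true; false)

bit : Bool → ℤ
bit false = + 0
bit true  = + 1

term : ℕ → (x y z : ℕ → Bool) → ℕ → ℤ
term k x y z i = (bit (x i) + bit (z i) - (+ k) * bit (y i)) * (+ (2 ^ i))

-- S k x y z n t = Σ_{i = n-t}^{n} (x_i + z_i - k y_i) 2^i   (for t ≤ n)
-- defined by recursion on t: S_0 = term n, S_{t+1} = S_t + term (n - (t+1))
S : ℕ → (x y z : ℕ → Bool) → ℕ → ℕ → ℤ
S k x y z n zero    = term k x y z n
S k x y z n (suc t) = S k x y z n t + term k x y z (n ∸ suc t)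

{-# OPTIONS --safe #-}
-- Since k is odd, x ⊕ y ⊕ z = 0 makes every coefficient x_i + z_i - k y_i even, so S_t is a
-- multiple of 2 · 2^(n-t) = 4P with P = 2^(n-t-1); write S_t = 4qP.  The hypothesis on S_t
-- then says m + 1 ≤ q and 4q < 8m + 6, i.e. q ≤ 2m + 1.  Now S_(t+1) = (4q + c)P for the next
-- coefficient c: in case (a) c = 1 - k, giving 2 ≤ 4q + c ≤ k - 1; in case (b) c ∈ {0, 2},
-- giving 4q + c ≥ 4m + 4 > k.
module Submission where

open import Defs
open import Data.Nat using (ℕ; zero; suc; _∸_; _^_)
import Data.Nat as ℕ
import Data.Nat.Properties as ℕ
import Data.Nat.Tactic.RingSolver as ℕ-Ring
open import Data.Integer
  using (ℤ; +_; _+_; _-_; -_; _*_; _≤_; _<_; +≤+; +<+; Positive; NonNegative; positive; nonNegative)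
import Data.Integer.Properties as ℤ
open import Data.Integer.Tactic.RingSolver using (solve)
open import Data.List using (_∷_; [])
open import Data.Bool using (Bool; true; false; _xor_)
open import Data.Product using (_×_; _,_; proj₁; proj₂; ∃-syntax)
open import Data.Sum using (_⊎_; inj₁; inj₂)
open import Relation.Binary.PropositionalEquality
  using (_≡_; refl; sym; trans; cong; cong₂; subst; subst₂; module ≡-Reasoning)

-- term k x y z i is definitionally coeff k (x i) (y i) (z i) * + (2 ^ i).
coeff : ℕ → Bool → Bool → Bool → ℤ
coeff k a b c = bit a + bit c - + k * bit b

coeff-without-y : ∀ k a c → coeff k a false c ≡ bit a + bit c
coeff-without-y k a c = trans (cong (λ v → bit a + bit c - v) (ℤ.*-zeroʳ (+ k))) (ℤ.+-identityʳ _)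

coeff-with-y : ∀ k a c → coeff k a true c ≡ bit a + bit c - + k
coeff-with-y k a c = cong (λ v → bit a + bit c - v) (ℤ.*-identityʳ (+ k))

pos-affine : ∀ a m b → + (a ℕ.* m ℕ.+ b) ≡ + a * + m + + b
pos-affine a m b = trans (ℤ.pos-+ (a ℕ.* m) b) (cong (_+ + b) (ℤ.pos-* a m))

one-minus-odd : ∀ l → + 1 - + suc (2 ℕ.* l) ≡ + 2 * - + l
one-minus-odd l = begin
  + 1 - + suc (2 ℕ.* l)        ≡⟨ cong (λ v → + 1 - (+ 1 + v)) (ℤ.pos-* 2 l) ⟩
  + 1 - (+ 1 + + 2 * + l)      ≡⟨ cancel-one (+ l) ⟩
  + 2 * - + l                  ∎
  where
  open ≡-Reasoning
  cancel-one : ∀ L → + 1 - (+ 1 + + 2 * L) ≡ + 2 * - L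
  cancel-one L = solve (L ∷ [])

coeff-even : ∀ {k} l → k ≡ suc (2 ℕ.* l) → ∀ a b c → (a xor b) xor c ≡ false →
             ∃[ e ] coeff k a b c ≡ + 2 * e
coeff-even {k} l refl false false false _ = + 0 , coeff-without-y k false false
coeff-even {k} l refl true  false true  _ = + 1 , coeff-without-y k true true
coeff-even {k} l refl true  true  false _ = - + l , trans (coeff-with-y k true false) (one-minus-odd l)
coeff-even {k} l refl false true  true  _ = - + l , trans (coeff-with-y k false true) (one-minus-odd l)
coeff-even     l refl false false true  ()
coeff-even     l refl false true  false ()
coeff-even     l refl true  false false ()
coeff-even     l refl true  true  true  ()

pow-half : ∀ {n t} → suc t ℕ.≤ n → + (2 ^ (n ∸ t)) ≡ + 2 * + (2 ^ (n ∸ suc t))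
pow-half {n} {t} t<n =
  trans (cong (λ d → + (2 ^ d)) (ℕ.+-∸-assoc 1 t<n)) (ℤ.pos-* 2 (2 ^ (n ∸ suc t)))

S-divisible : ∀ {k} l → k ≡ suc (2 ℕ.* l) → ∀ n t (x y z : ℕ → Bool) → t ℕ.≤ n →
  (∀ i → n ∸ t ℕ.≤ i → i ℕ.≤ n → (x i xor y i) xor z i ≡ false) →
  ∃[ q ] S k x y z n t ≡ q * (+ 2 * + (2 ^ (n ∸ t)))
S-divisible {k} l odd n zero x y z _ balanced =
  let e , c≡2e = coeff-even l odd (x n) (y n) (z n) (balanced n ℕ.≤-refl ℕ.≤-refl)
  in e , (begin
    coeff k (x n) (y n) (z n) * P   ≡⟨ cong (_* P) c≡2e ⟩
    + 2 * e * P                     ≡⟨ cong (_* P) (ℤ.*-comm (+ 2) e) ⟩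
    e * + 2 * P                     ≡⟨ ℤ.*-assoc e (+ 2) P ⟩
    e * (+ 2 * P)                   ∎)
  where
  open ≡-Reasoning
  P : ℤ
  P = + (2 ^ n)
S-divisible {k} l odd n (suc t) x y z t<n balanced =
  let q , Sₜ≡ = S-divisible l odd n t x y z (ℕ.<⇒≤ t<n) balanced-from-t
      d , c≡2d = coeff-even l odd (x e) (y e) (z e) (balanced e ℕ.≤-refl (ℕ.m∸n≤m n (suc t)))
  in + 2 * q + d , (begin
    S k x y z n t + coeff k (x e) (y e) (z e) * P   ≡⟨ cong₂ _+_ Sₜ≡ (cong (_* P) c≡2d) ⟩
    q * (+ 2 * + (2 ^ (n ∸ t))) + + 2 * d * P       ≡⟨ cong (λ Q → q * (+ 2 * Q) + + 2 * d * P) (pow-half t<n) ⟩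
    q * (+ 2 * (+ 2 * P)) + + 2 * d * P             ≡⟨ regroup q d P ⟩
    (+ 2 * q + d) * (+ 2 * P)                       ∎)
  where
  open ≡-Reasoning
  e : ℕ
  e = n ∸ suc t
  P : ℤ
  P = + (2 ^ e)
  balanced-from-t : ∀ i → n ∸ t ℕ.≤ i → i ℕ.≤ n → (x i xor y i) xor z i ≡ false
  balanced-from-t i lo = balanced i (ℕ.≤-trans (ℕ.∸-monoʳ-≤ n (ℕ.n≤1+n t)) lo)
  regroup : ∀ q d P → q * (+ 2 * (+ 2 * P)) + + 2 * d * P ≡ (+ 2 * q + d) * (+ 2 * P)
  regroup q d P = solve (q ∷ d ∷ P ∷ [])

4m+3-odd : ∀ m → 4 ℕ.* m ℕ.+ 3 ≡ suc (2 ℕ.* (2 ℕ.* m ℕ.+ 1))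
4m+3-odd = ℕ-Ring.solve-∀

module _ {P : ℤ} .{{_ : Positive P}} where

  private instance
    P≥0 : NonNegative P
    P≥0 = nonNegative (ℤ.<⇒≤ (ℤ.positive⁻¹ P))

  quotient-lower : ∀ M q → (+ 2 * M + + 2) * (+ 2 * P) ≤ q * (+ 2 * (+ 2 * P)) → M + + 1 ≤ q
  quotient-lower M q h = ℤ.*-cancelˡ-≤-pos (M + + 1) q (+ 4) (ℤ.*-cancelʳ-≤-pos _ _ P (begin
    + 4 * (M + + 1) * P             ≡⟨ solve (M ∷ P ∷ []) ⟩
    (+ 2 * M + + 2) * (+ 2 * P)     ≤⟨ h ⟩
    q * (+ 2 * (+ 2 * P))           ≡⟨ solve (q ∷ P ∷ []) ⟩
    + 4 * q * P                     ∎))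
    where open ℤ.≤-Reasoning

  -- Since 4q is a multiple of 4, 4q < 8M + 6 already forces 4q < 8M + 8.
  quotient-upper : ∀ M q → q * (+ 2 * (+ 2 * P)) < (+ 4 * M + + 3) * (+ 2 * P) → q < + 2 * M + + 2
  quotient-upper M q h = ℤ.*-cancelˡ-<-nonNeg (+ 4) (ℤ.*-cancelʳ-<-nonNeg P (begin-strict
    + 4 * q * P                     ≡⟨ solve (q ∷ P ∷ []) ⟩
    q * (+ 2 * (+ 2 * P))           <⟨ h ⟩
    (+ 4 * M + + 3) * (+ 2 * P)     ≡⟨ solve (M ∷ P ∷ []) ⟩
    (+ 8 * M + + 6) * P             ≤⟨ ℤ.*-monoʳ-≤-nonNeg P (ℤ.+-monoʳ-≤ (+ 8 * M) (+≤+ (ℕ.m≤m+n 6 2))) ⟩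
    (+ 8 * M + + 8) * P             ≡⟨ solve (M ∷ P ∷ []) ⟩
    + 4 * (+ 2 * M + + 2) * P       ∎))
    where open ℤ.≤-Reasoning

  next-within-range : ∀ {K} M q → K ≡ + 4 * M + + 3 → M + + 1 ≤ q → q < + 2 * M + + 2 →
    (+ 0 ≤ q * (+ 2 * (+ 2 * P)) + (+ 1 - K) * P) × (q * (+ 2 * (+ 2 * P)) + (+ 1 - K) * P < K * P)
  next-within-range M q refl lo hi = nonneg , below-K
    where
    open ℤ.≤-Reasoning
    nonneg : + 0 ≤ q * (+ 2 * (+ 2 * P)) + (+ 1 - (+ 4 * M + + 3)) * P
    nonneg = begin
      + 0                                                 ≤⟨ ℤ.*-monoʳ-≤-nonNeg P {+ 0} {+ 2} (+≤+ ℕ.z≤n) ⟩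
      + 2 * P                                             ≡⟨ solve (M ∷ P ∷ []) ⟩
      (+ 4 * (M + + 1) + (+ 1 - (+ 4 * M + + 3))) * P     ≤⟨ ℤ.*-monoʳ-≤-nonNeg P (ℤ.+-monoˡ-≤ _
                                                               (ℤ.*-monoˡ-≤-nonNeg (+ 4) lo)) ⟩
      (+ 4 * q + (+ 1 - (+ 4 * M + + 3))) * P             ≡⟨ solve (M ∷ q ∷ P ∷ []) ⟩
      q * (+ 2 * (+ 2 * P)) + (+ 1 - (+ 4 * M + + 3)) * P ∎
    below-K : q * (+ 2 * (+ 2 * P)) + (+ 1 - (+ 4 * M + + 3)) * P < (+ 4 * M + + 3) * P
    below-K = begin-strict
      q * (+ 2 * (+ 2 * P)) + (+ 1 - (+ 4 * M + + 3)) * P ≡⟨ solve (M ∷ q ∷ P ∷ []) ⟩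
      (+ 4 * (+ 1 + q) - (+ 4 * M + + 6)) * P             ≤⟨ ℤ.*-monoʳ-≤-nonNeg P (ℤ.+-monoˡ-≤ _
                                                               (ℤ.*-monoˡ-≤-nonNeg (+ 4) (ℤ.i<j⇒suc[i]≤j hi))) ⟩
      (+ 4 * (+ 2 * M + + 2) - (+ 4 * M + + 6)) * P       ≡⟨ solve (M ∷ P ∷ []) ⟩
      (+ 4 * M + + 2) * P                                 <⟨ ℤ.*-monoʳ-<-pos P
                                                               (ℤ.+-monoʳ-< (+ 4 * M) (+<+ (ℕ.n<1+n 2))) ⟩
      (+ 4 * M + + 3) * P                                 ∎

  next-above-range : ∀ {K} M q c .{{_ : NonNegative c}} → K ≡ + 4 * M + + 3 → M + + 1 ≤ q →
    K * P ≤ q * (+ 2 * (+ 2 * P)) + c * P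
  next-above-range M q c refl lo = begin
    (+ 4 * M + + 3) * P           ≤⟨ ℤ.*-monoʳ-≤-nonNeg P (ℤ.+-monoʳ-≤ (+ 4 * M) (+≤+ (ℕ.n≤1+n 3))) ⟩
    (+ 4 * M + + 4) * P           ≡⟨ solve (M ∷ P ∷ []) ⟩
    + 4 * (M + + 1) * P           ≤⟨ ℤ.*-monoʳ-≤-nonNeg P (ℤ.*-monoˡ-≤-nonNeg (+ 4) lo) ⟩
    + 4 * q * P                   ≤⟨ ℤ.*-monoʳ-≤-nonNeg P (ℤ.i≤i+j (+ 4 * q) c) ⟩
    (+ 4 * q + c) * P             ≡⟨ solve (q ∷ c ∷ P ∷ []) ⟩
    q * (+ 2 * (+ 2 * P)) + c * P ∎
    where open ℤ.≤-Reasoning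

lemma2p8 : (m n t : ℕ) (x y z : ℕ → Bool) →
    let k = 4 Data.Nat.* m Data.Nat.+ 3 in
    suc t Data.Nat.≤ n →
    (+ (2 Data.Nat.* m Data.Nat.+ 2)) * (+ (2 ^ (n ∸ t))) ≤ S k x y z n t →
    S k x y z n t < (+ k) * (+ (2 ^ (n ∸ t))) →
    (∀ i → n ∸ t Data.Nat.≤ i → i Data.Nat.≤ n → (x i xor y i) xor z i ≡ false) →
    (((x (n ∸ suc t) ≡ true × y (n ∸ suc t) ≡ true × z (n ∸ suc t) ≡ false)
       ⊎ (x (n ∸ suc t) ≡ false × y (n ∸ suc t) ≡ true × z (n ∸ suc t) ≡ true)) →
      (+ 0 ≤ S k x y z n (suc t)) × (S k x y z n (suc t) < (+ k) * (+ (2 ^ (n ∸ suc t)))))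
    × (((x (n ∸ suc t) ≡ true × y (n ∸ suc t) ≡ false × z (n ∸ suc t) ≡ true)
       ⊎ (x (n ∸ suc t) ≡ false × y (n ∸ suc t) ≡ false × z (n ∸ suc t) ≡ false)) →
      (+ k) * (+ (2 ^ (n ∸ suc t))) ≤ S k x y z n (suc t))
lemma2p8 m n t x y z t<n lower upper balanced =
    (λ { (inj₁ (x≡1 , y≡1 , z≡0)) → within (Sₜ₊₁≡ x≡1 y≡1 z≡0 (coeff-with-y k true false))
       ; (inj₂ (x≡0 , y≡1 , z≡1)) → within (Sₜ₊₁≡ x≡0 y≡1 z≡1 (coeff-with-y k false true)) })
  , (λ { (inj₁ (x≡1 , y≡0 , z≡1)) → above (+ 2) (Sₜ₊₁≡ x≡1 y≡0 z≡1 (coeff-without-y k true true))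
       ; (inj₂ (x≡0 , y≡0 , z≡0)) → above (+ 0) (Sₜ₊₁≡ x≡0 y≡0 z≡0 (coeff-without-y k false false)) })
  where
  k e : ℕ
  k = 4 ℕ.* m ℕ.+ 3
  e = n ∸ suc t
  P : ℤ
  P = + (2 ^ e)
  instance
    P>0 : Positive P
    P>0 = positive (+<+ (ℕ.m^n>0 2 e))

  k≡ : + k ≡ + 4 * + m + + 3
  k≡ = pos-affine 4 m 3

  divisible : ∃[ q ] S k x y z n t ≡ q * (+ 2 * + (2 ^ (n ∸ t)))
  divisible = S-divisible (2 ℕ.* m ℕ.+ 1) (4m+3-odd m) n t x y z (ℕ.<⇒≤ t<n) balanced
  q : ℤ
  q = proj₁ divisible

  Sₜ≡ : S k x y z n t ≡ q * (+ 2 * (+ 2 * P))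
  Sₜ≡ = trans (proj₂ divisible) (cong (λ Q → q * (+ 2 * Q)) (pow-half t<n))

  q-lower : + m + + 1 ≤ q
  q-lower = quotient-lower (+ m) q
    (subst₂ _≤_ (cong₂ _*_ (pos-affine 2 m 2) (pow-half t<n)) Sₜ≡ lower)

  q-upper : q < + 2 * + m + + 2
  q-upper = quotient-upper (+ m) q (subst₂ _<_ Sₜ≡ (cong₂ _*_ k≡ (pow-half t<n)) upper)

  Sₜ₊₁≡ : ∀ {a b c v} → x e ≡ a → y e ≡ b → z e ≡ c → coeff k a b c ≡ v →
          S k x y z n (suc t) ≡ q * (+ 2 * (+ 2 * P)) + v * P
  Sₜ₊₁≡ refl refl refl refl = cong (_+ coeff k (x e) (y e) (z e) * P) Sₜ≡

  within : S k x y z n (suc t) ≡ q * (+ 2 * (+ 2 * P)) + (+ 1 - + k) * P →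
           (+ 0 ≤ S k x y z n (suc t)) × (S k x y z n (suc t) < + k * P)
  within eq = subst (λ s → (+ 0 ≤ s) × (s < + k * P)) (sym eq)
                    (next-within-range (+ m) q k≡ q-lower q-upper)

  above : ∀ c .{{_ : NonNegative c}} → S k x y z n (suc t) ≡ q * (+ 2 * (+ 2 * P)) + c * P →
         + k * P ≤ S k x y z n (suc t)
  above c eq = subst (+ k * P ≤_) (sym eq) (next-above-range (+ m) q c k≡ q-lower)
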